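{- Let $M=(f,G,Z,\mathrm{id})$ and $N=(f_N,G_N,Z_N,\mathrm{id}_N)$ be maps and let $(\phi,\psi):M\to N$ be a map morphism. Then $N$ is isomorphic to the $K$-quotient $M/K$, where $K=\psi^{ -1}\big((G_N)_{\mathrm{id}_N}\big)$ and $(G_N)_{\mathrm{id}_N}$ is the stabilizer of $\mathrm{id}_N$ in $G_N$. In particular, every image $N$ of a map morphism from $M$ is isomorphic to some $K$-quotient $M/K$ with $G_{\mathrm{id}}\le K\le G$.
   Context: Let $F=\langle t,l,r\mid t^2=l^2=r^2=(tl)^2=1\rangle$. A (finite rooted) map is a quadruple $M=(f,G,Z,\mathrm{id})$, where $Z$ is a finite set of flags, $G$ is a group of permutations of $Z$ acting on the right, transitively and faithfully, $f:F\to G$ is an epimorphism, and $\mathrm{id}\in Z$ is the root. A morphism $(\phi,\psi):M\to N$ of maps $M=(f_M,G_M,Z_M,\mathrm{id}_M)$, $N=(f_N,G_N,Z_N,\mathrm{id}_N)$ consists of a group epimorphism $\psi:G_M\to G_N$ with $\psi\circ f_M=f_N$ and a surjection $\phi:Z_M\to Z_N$ with $\phi(\mathrm{id}_M)=\mathrm{id}_N$ and $\phi(z\cdot g)=\phi(z)\cdot\psi(g)$ for all $z,g$; it is an isomorphism if $\phi$ and $\psi$ are bijective. $K$-quotient: for a subgroup $K$ with $G_{\mathrm{id}}\le K\le G$, let $H$ be the kernel of the right action of $G$ on the set $G/K$ of right cosets ($Ka\cdot b=Kab$), and $q:G\to G/H$ the natural epimorphism; $G/H$ acts faithfully and transitively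 on $G/K$ by $Ka\cdot Hb=Kab$, and $M/K:=(q\circ f,G/H,G/K,K)$. -}

module Defs where

open import Level using (0ℓ) renaming (suc to lsuc)
open import Data.Nat using (ℕ)
open import Data.Fin using (Fin)
open import Data.List using (List; []; _∷_; _++_; reverse; [_])
open import Data.List.Properties using (++-assoc; ++-identityʳ; reverse-++; reverse-involutive)
open import Data.Product using (Σ; ∃; _,_; proj₁; proj₂)
open import Algebra.Bundles using (Group)
open import Algebra.Structures using (IsGroup)
open import Algebra.Morphism.Structures using (module GroupMorphisms)
open import Relation.Binary.Bundles using (Setoid)
open import Relation.Binary.Structures using (IsEquivalence)
import Relation.Binary.PropositionalEquality as ≡
open ≡ using (_≡_)
open import Function.Definitions using (Injective; Surjective)
open import Function.Bundles using (Inverse)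
import Algebra.Properties.Group as GroupProps
import Relation.Binary.Reasoning.Setoid as SetoidReasoning

-- The group F = ⟨ t , l , r ∣ t² = l² = r² = (tl)² = 1 ⟩.
-- Realised as words over {t,l,r} modulo the congruence generated by the
-- defining relators (since every generator is an involution, the free
-- monoid on t,l,r already surjects onto the free group quotient, and the
-- inverse of a word is its reverse).

data Gen : Set where
  t l r : Gen

Word : Set
Word = List Gen

infix 4 _≈F_
data _≈F_ : Word → Word → Set where
  F-refl  : ∀ {u} → u ≈F u
  F-sym   : ∀ {u v} → u ≈F v → v ≈F u
  F-trans : ∀ {u v w} → u ≈F v → v ≈F w → u ≈F w
  F-cong  : ∀ {u u' v v'} → u ≈F u' → v ≈F v' → u ++ v ≈F u' ++ v'
  F-inv   : ∀ (x : Gen) → x ∷ x ∷ [] ≈F []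
  F-tl    : t ∷ l ∷ t ∷ l ∷ [] ≈F []

private
  ≡⇒≈F : ∀ {u v} → u ≡ v → u ≈F v
  ≡⇒≈F ≡.refl = F-refl

  ∷-cong : ∀ x {u v} → u ≈F v → x ∷ u ≈F x ∷ v
  ∷-cong x p = F-cong {u = [ x ]} F-refl p

  lt : l ∷ t ∷ l ∷ t ∷ [] ≈F []
  lt = F-trans (F-sym (F-cong {u = l ∷ t ∷ l ∷ t ∷ []} F-refl (F-inv l)))
        (F-trans (∷-cong l (F-cong {u = t ∷ l ∷ t ∷ l ∷ []} F-tl F-refl)) (F-inv l))

  rev-cong : ∀ {u v} → u ≈F v → reverse u ≈F reverse v
  rev-cong F-refl = F-refl
  rev-cong (F-sym p) = F-sym (rev-cong p)
  rev-cong (F-trans p q) = F-trans (rev-cong p) (rev-cong q)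
  rev-cong (F-cong {u} {u'} {v} {v'} p q) =
    F-trans (≡⇒≈F (reverse-++ u v))
      (F-trans (F-cong (rev-cong q) (rev-cong p)) (≡⇒≈F (≡.sym (reverse-++ u' v'))))
  rev-cong (F-inv x) = F-inv x
  rev-cong F-tl = lt

  invʳ : ∀ w → w ++ reverse w ≈F []
  invʳ [] = F-refl
  invʳ (x ∷ w) =
    F-trans (∷-cong x (≡⇒≈F (≡.trans (≡.cong (w ++_) (reverse-++ [ x ] w))
                                     (≡.sym (++-assoc w (reverse w) [ x ])))))
      (F-trans (∷-cong x (F-cong (invʳ w) (F-refl {u = [ x ]}))) (F-inv x))

  invˡ : ∀ w → reverse w ++ w ≈F []
  invˡ w = F-trans (≡⇒≈F (≡.cong (reverse w ++_) (≡.sym (reverse-involutive w))))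
                   (invʳ (reverse w))

F : Group 0ℓ 0ℓ
F = record
  { Carrier = Word
  ; _≈_ = _≈F_
  ; _∙_ = _++_
  ; ε = []
  ; _⁻¹ = reverse
  ; isGroup = record
    { isMonoid = record
      { isSemigroup = record
        { isMagma = record
          { isEquivalence = record { refl = F-refl ; sym = F-sym ; trans = F-trans }
          ; ∙-cong = F-cong }
        ; assoc = λ x y z → ≡⇒≈F (++-assoc x y z) }
      ; identity = (λ _ → F-refl) , (λ x → ≡⇒≈F (++-identityʳ x)) }
    ; inverse = invˡ , invʳ
    ; ⁻¹-cong = rev-cong }
  }

IsGroupHom : (G H : Group 0ℓ 0ℓ) → (Group.Carrier G → Group.Carrier H) → Set
IsGroupHom G H = GroupMorphisms.IsGroupHomomorphism (Group.rawGroup G) (Group.rawGroup H)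

record Subgroup (G : Group 0ℓ 0ℓ) : Set₁ where
  open Group G
  field
    P    : Carrier → Set
    resp : ∀ {x y} → x ≈ y → P x → P y
    ε∈   : P ε
    ∙∈   : ∀ {x y} → P x → P y → P (x ∙ y)
    ⁻¹∈  : ∀ {x} → P x → P (x ⁻¹)

_≤G_ : ∀ {G} → Subgroup G → Subgroup G → Set
_≤G_ {G} H K = ∀ (g : Group.Carrier G) → Subgroup.P H g → Subgroup.P K g

record IsRightAction (Z : Setoid 0ℓ 0ℓ) (G : Group 0ℓ 0ℓ)
       (_·_ : Setoid.Carrier Z → Group.Carrier G → Setoid.Carrier Z) : Set where
  private
    module Z = Setoid Z
    module G = Group G
  field
    ·-cong   : ∀ {z z' g g'} → z Z.≈ z' → g G.≈ g' → (z · g) Z.≈ (z' · g')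
    ·-ε      : ∀ z → (z · G.ε) Z.≈ z
    ·-∙      : ∀ z g h → (z · (g G.∙ h)) Z.≈ ((z · g) · h)

record PreMap : Set₁ where
  field
    Z          : Setoid 0ℓ 0ℓ          -- flags
    G          : Group 0ℓ 0ℓ
  module Z = Setoid Z
  module G = Group G
  field
    _·_        : Z.Carrier → G.Carrier → Z.Carrier
    isAction   : IsRightAction Z G _·_
    transitive : ∀ z w → ∃ λ g → (z · g) Z.≈ w
    faithful   : ∀ g h → (∀ z → (z · g) Z.≈ (z · h)) → g G.≈ h
    f          : Group.Carrier F → G.Carrier
    f-hom      : IsGroupHom F G f
    f-epi      : Surjective (Group._≈_ F) G._≈_ f
    root       : Z.Carrier
  open IsRightAction isAction public

record Map : Set₁ where
  field
    premap : PreMap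
  open PreMap premap public
  field
    finite : Σ ℕ λ n → Inverse (≡.setoid (Fin n)) Z

record Morphism (M N : PreMap) : Set where
  private
    module M = PreMap M
    module N = PreMap N
  field
    ψ       : M.G.Carrier → N.G.Carrier
    ψ-hom   : IsGroupHom M.G N.G ψ
    ψ-epi   : Surjective M.G._≈_ N.G._≈_ ψ
    ψ-f     : ∀ w → ψ (M.f w) N.G.≈ N.f w
    φ       : M.Z.Carrier → N.Z.Carrier
    φ-cong  : ∀ {z z'} → z M.Z.≈ z' → φ z N.Z.≈ φ z'
    φ-surj  : Surjective M.Z._≈_ N.Z._≈_ φ
    φ-root  : φ M.root N.Z.≈ N.root
    φ-equiv : ∀ z g → φ (z M.· g) N.Z.≈ (φ z N.· ψ g)

record Isomorphism (M N : PreMap) : Set where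
  private
    module M = PreMap M
    module N = PreMap N
  field
    morphism : Morphism M N
  open Morphism morphism public
  field
    ψ-inj : Injective M.G._≈_ N.G._≈_ ψ
    φ-inj : Injective M.Z._≈_ N.Z._≈_ φ

Stab : (M : PreMap) → Subgroup (PreMap.G M)
Stab M = record
  { P = λ g → (root · g) Z.≈ root
  ; resp = λ x≈y p → Z.trans (·-cong Z.refl (G.sym x≈y)) p
  ; ε∈ = ·-ε root
  ; ∙∈ = λ {x} {y} px py → Z.trans (·-∙ root x y) (Z.trans (·-cong px G.refl) py)
  ; ⁻¹∈ = λ {x} px →
      Z.trans (·-cong (Z.sym px) G.refl)
        (Z.trans (Z.sym (·-∙ root x (x G.⁻¹)))
          (Z.trans (·-cong Z.refl (G.inverseʳ x)) (·-ε root)))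
  }
  where open PreMap M

preimage : ∀ {G H : Group 0ℓ 0ℓ} (ψ : Group.Carrier G → Group.Carrier H) →
           IsGroupHom G H ψ → Subgroup H → Subgroup G
preimage {G} {H} ψ hom K = record
  { P = λ g → K.P (ψ g)
  ; resp = λ x≈y → K.resp (hom.⟦⟧-cong x≈y)
  ; ε∈ = K.resp (H.sym hom.ε-homo) K.ε∈
  ; ∙∈ = λ {x} {y} px py → K.resp (H.sym (hom.homo x y)) (K.∙∈ px py)
  ; ⁻¹∈ = λ {x} px → K.resp (H.sym (hom.⁻¹-homo x)) (K.⁻¹∈ px)
  }
  where
    module K = Subgroup K
    module H = Group H
    module hom = GroupMorphisms.IsGroupHomomorphism hom

-- The K-quotient M/K.
--   flags:  the right cosets G/K, realised as the setoid on G with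
--           a ∼ b  iff  Ka = Kb  iff  a b⁻¹ ∈ K;
--   group:  G/H with H the kernel of the action of G on G/K, realised as
--           G with  a ≈ b  iff  a and b act identically on G/K
--           (i.e. a b⁻¹ ∈ H);
--   action: Ka · Hb = Kab;  epimorphism q ∘ f;  root K = Kε.
-- (The paper assumes G_id ≤ K; the construction does not need it, so it
-- is not a parameter here; the theorem proves it separately.)

module Quotient (M : PreMap) (K : Subgroup (PreMap.G M)) where
  private
    module M = PreMap M
    module K = Subgroup K
    open M.G
    open GroupProps M.G
    open SetoidReasoning M.G.setoid

  _∼_ : Carrier → Carrier → Set
  a ∼ b = K.P (a ∙ b ⁻¹)

  ∼-refl : ∀ {a} → a ∼ a
  ∼-refl {a} = K.resp (sym (inverseʳ a)) K.ε∈

  ∼-sym : ∀ {a b} → a ∼ b → b ∼ a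
  ∼-sym {a} {b} p = K.resp eq (K.⁻¹∈ p)
    where
      eq : (a ∙ b ⁻¹) ⁻¹ ≈ b ∙ a ⁻¹
      eq = begin
        (a ∙ b ⁻¹) ⁻¹     ≈⟨ ⁻¹-anti-homo-∙ a (b ⁻¹) ⟩
        b ⁻¹ ⁻¹ ∙ a ⁻¹    ≈⟨ ∙-congʳ (⁻¹-involutive b) ⟩
        b ∙ a ⁻¹          ∎

  ∼-trans : ∀ {a b c} → a ∼ b → b ∼ c → a ∼ c
  ∼-trans {a} {b} {c} p q = K.resp eq (K.∙∈ p q)
    where
      eq : (a ∙ b ⁻¹) ∙ (b ∙ c ⁻¹) ≈ a ∙ c ⁻¹
      eq = begin
        (a ∙ b ⁻¹) ∙ (b ∙ c ⁻¹)   ≈⟨ assoc a (b ⁻¹) (b ∙ c ⁻¹) ⟩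
        a ∙ (b ⁻¹ ∙ (b ∙ c ⁻¹))   ≈⟨ ∙-congˡ (sym (assoc (b ⁻¹) b (c ⁻¹))) ⟩
        a ∙ ((b ⁻¹ ∙ b) ∙ c ⁻¹)   ≈⟨ ∙-congˡ (∙-congʳ (inverseˡ b)) ⟩
        a ∙ (ε ∙ c ⁻¹)            ≈⟨ ∙-congˡ (identityˡ (c ⁻¹)) ⟩
        a ∙ c ⁻¹                  ∎

  ≈⇒∼ : ∀ {a b} → a ≈ b → a ∼ b
  ≈⇒∼ {a} {b} a≈b = K.resp (∙-congˡ (⁻¹-cong a≈b)) (∼-refl {a})

  ∼-∙ʳ : ∀ {a b} g → a ∼ b → (a ∙ g) ∼ (b ∙ g)
  ∼-∙ʳ {a} {b} g p = K.resp (sym eq) p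
    where
      eq : (a ∙ g) ∙ (b ∙ g) ⁻¹ ≈ a ∙ b ⁻¹
      eq = begin
        (a ∙ g) ∙ (b ∙ g) ⁻¹      ≈⟨ ∙-congˡ (⁻¹-anti-homo-∙ b g) ⟩
        (a ∙ g) ∙ (g ⁻¹ ∙ b ⁻¹)   ≈⟨ assoc a g (g ⁻¹ ∙ b ⁻¹) ⟩
        a ∙ (g ∙ (g ⁻¹ ∙ b ⁻¹))   ≈⟨ ∙-congˡ (sym (assoc g (g ⁻¹) (b ⁻¹))) ⟩
        a ∙ ((g ∙ g ⁻¹) ∙ b ⁻¹)   ≈⟨ ∙-congˡ (∙-congʳ (inverseʳ g)) ⟩
        a ∙ (ε ∙ b ⁻¹)            ≈⟨ ∙-congˡ (identityˡ (b ⁻¹)) ⟩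
        a ∙ b ⁻¹                  ∎

  Cosets : Setoid 0ℓ 0ℓ
  Cosets = record
    { Carrier = Carrier
    ; _≈_ = _∼_
    ; isEquivalence = record { refl = ∼-refl ; sym = ∼-sym ; trans = ∼-trans } }

  _≈H_ : Carrier → Carrier → Set
  a ≈H b = ∀ x → (x ∙ a) ∼ (x ∙ b)

  ≈⇒≈H : ∀ {a b} → a ≈ b → a ≈H b
  ≈⇒≈H a≈b x = ≈⇒∼ (∙-congˡ a≈b)

  private
    ∙-congH : ∀ {a a' b b'} → a ≈H a' → b ≈H b' → (a ∙ b) ≈H (a' ∙ b')
    ∙-congH {a} {a'} {b} {b'} p q x =
      ∼-trans (≈⇒∼ (sym (assoc x a b)))
        (∼-trans (∼-∙ʳ b (p x))
          (∼-trans (q (x ∙ a')) (≈⇒∼ (assoc x a' b'))))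

    ⁻¹-congH : ∀ {a a'} → a ≈H a' → (a ⁻¹) ≈H (a' ⁻¹)
    ⁻¹-congH {a} {a'} p x = ∼-sym (∼-trans (≈⇒∼ (sym e1)) (∼-trans h (≈⇒∼ e2)))
      where
        y = x ∙ a ⁻¹
        h : ((y ∙ a) ∙ a' ⁻¹) ∼ ((y ∙ a') ∙ a' ⁻¹)
        h = ∼-∙ʳ (a' ⁻¹) (p y)
        e1 : (y ∙ a) ∙ a' ⁻¹ ≈ x ∙ a' ⁻¹
        e1 = begin
          ((x ∙ a ⁻¹) ∙ a) ∙ a' ⁻¹   ≈⟨ ∙-congʳ (assoc x (a ⁻¹) a) ⟩
          (x ∙ (a ⁻¹ ∙ a)) ∙ a' ⁻¹   ≈⟨ ∙-congʳ (∙-congˡ (inverseˡ a)) ⟩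
          (x ∙ ε) ∙ a' ⁻¹            ≈⟨ ∙-congʳ (identityʳ x) ⟩
          x ∙ a' ⁻¹                  ∎
        e2 : (y ∙ a') ∙ a' ⁻¹ ≈ x ∙ a ⁻¹
        e2 = begin
          (y ∙ a') ∙ a' ⁻¹           ≈⟨ assoc y a' (a' ⁻¹) ⟩
          y ∙ (a' ∙ a' ⁻¹)           ≈⟨ ∙-congˡ (inverseʳ a') ⟩
          y ∙ ε                      ≈⟨ identityʳ y ⟩
          x ∙ a ⁻¹                   ∎

  GH : Group 0ℓ 0ℓ
  GH = record
    { Carrier = Carrier
    ; _≈_ = _≈H_
    ; _∙_ = _∙_
    ; ε = ε
    ; _⁻¹ = _⁻¹
    ; isGroup = record
      { isMonoid = record
        { isSemigroup = record
          { isMagma = record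
            { isEquivalence = record
              { refl = λ x → ∼-refl
              ; sym = λ p x → ∼-sym (p x)
              ; trans = λ p q x → ∼-trans (p x) (q x) }
            ; ∙-cong = ∙-congH }
          ; assoc = λ x y z → ≈⇒≈H (assoc x y z) }
        ; identity = (λ x → ≈⇒≈H (identityˡ x)) , (λ x → ≈⇒≈H (identityʳ x)) }
      ; inverse = (λ x → ≈⇒≈H (inverseˡ x)) , (λ x → ≈⇒≈H (inverseʳ x))
      ; ⁻¹-cong = ⁻¹-congH }
    }

  private
    module fh = GroupMorphisms.IsGroupHomomorphism M.f-hom

  quotient : PreMap
  quotient = record
    { Z = Cosets
    ; G = GH
    ; _·_ = _∙_
    ; isAction = record
      { ·-cong = λ {z} {z'} {g} {g'} p q → ∼-trans (∼-∙ʳ g p) (q z')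
      ; ·-ε = λ z → ≈⇒∼ (identityʳ z)
      ; ·-∙ = λ z g h → ≈⇒∼ (sym (assoc z g h)) }
    ; transitive = λ a b → a ⁻¹ ∙ b ,
        ≈⇒∼ (trans (sym (assoc a (a ⁻¹) b))
               (trans (∙-congʳ (inverseʳ a)) (identityˡ b)))
    ; faithful = λ g h p → p
    ; f = M.f
    ; f-hom = record
      { isMonoidHomomorphism = record
        { isMagmaHomomorphism = record
          { isRelHomomorphism = record { cong = λ p → ≈⇒≈H (fh.⟦⟧-cong p) }
          ; homo = λ x y → ≈⇒≈H (fh.homo x y) }
        ; ε-homo = ≈⇒≈H fh.ε-homo }
      ; ⁻¹-homo = λ x → ≈⇒≈H (fh.⁻¹-homo x) }
    ; f-epi = λ y → proj₁ (M.f-epi y) , λ p → ≈⇒≈H (proj₂ (M.f-epi y) p)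
    ; root = ε
    }

_/_ : (M : PreMap) → Subgroup (PreMap.G M) → PreMap
M / K = Quotient.quotient M K

{-# OPTIONS --safe #-}
module Submission where

open import Defs
open import Level using (0ℓ)
open import Data.Product using (_×_; _,_; ∃)
open import Relation.Binary.Bundles using (Setoid)
open import Algebra.Bundles using (Group)
open import Algebra.Morphism.Structures using (module GroupMorphisms)
import Algebra.Properties.Group as GroupProperties
import Relation.Binary.Reasoning.Setoid as SetoidReasoning

-- The isomorphism M/K → N sends the coset Ka to root · ψ a.  Since G_N acts
-- transitively and ψ is onto, this orbit map identifies the cosets of
-- K = ψ⁻¹(Stab N) with the flags of N.  Two elements of G_M then act alike on the
-- cosets iff their images act alike on the flags of N, i.e. (N being faithful)
-- iff they have the same image under ψ; so ψ descends to an isomorphism from the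
-- monodromy group of M/K onto G_N.

module RightActionProperties
  {Z : Setoid 0ℓ 0ℓ} {G : Group 0ℓ 0ℓ}
  {_·_ : Setoid.Carrier Z → Group.Carrier G → Setoid.Carrier Z}
  (action : IsRightAction Z G _·_) where

  private
    module Z = Setoid Z
    module G = Group G
  open G using (_∙_; _⁻¹; _//_; ε)
  open IsRightAction action
  open GroupProperties G using (//-rightDividesˡ)
  open SetoidReasoning Z

  ·-congˡ : ∀ z {g h} → g G.≈ h → (z · g) Z.≈ (z · h)
  ·-congˡ z g≈h = ·-cong Z.refl g≈h

  ·-congʳ : ∀ {z z'} g → z Z.≈ z' → (z · g) Z.≈ (z' · g)
  ·-congʳ g z≈z' = ·-cong z≈z' G.refl

  z·u≈z·v⇒z·[u//v]≈z : ∀ z u v → (z · u) Z.≈ (z · v) → (z · (u // v)) Z.≈ z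
  z·u≈z·v⇒z·[u//v]≈z z u v z·u≈z·v = begin
    z · (u ∙ v ⁻¹)     ≈⟨ ·-∙ z u (v ⁻¹) ⟩
    (z · u) · (v ⁻¹)   ≈⟨ ·-congʳ (v ⁻¹) z·u≈z·v ⟩
    (z · v) · (v ⁻¹)   ≈⟨ ·-∙ z v (v ⁻¹) ⟨
    z · (v ∙ v ⁻¹)     ≈⟨ ·-congˡ z (G.inverseʳ v) ⟩
    z · ε              ≈⟨ ·-ε z ⟩
    z                  ∎

  z·[u//v]≈z⇒z·u≈z·v : ∀ z u v → (z · (u // v)) Z.≈ z → (z · u) Z.≈ (z · v)
  z·[u//v]≈z⇒z·u≈z·v z u v z·[u//v]≈z = begin
    z · u              ≈⟨ ·-congˡ z (//-rightDividesˡ v u) ⟨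
    z · ((u // v) ∙ v) ≈⟨ ·-∙ z (u // v) v ⟩
    (z · (u // v)) · v ≈⟨ ·-congʳ v z·[u//v]≈z ⟩
    z · v              ∎

module QuotientByMorphism (M N : PreMap) (m : Morphism M N) where
  private
    module M = PreMap M
    module N = PreMap N
    module ψ = GroupMorphisms.IsGroupHomomorphism (Morphism.ψ-hom m)
  open Morphism m
  open N using (_·_; root; ·-∙; ·-ε)
  open RightActionProperties N.isAction
  open SetoidReasoning N.Z

  K : Subgroup M.G
  K = preimage ψ ψ-hom (Stab N)

  open Quotient M K using (_∼_; _≈H_; GH)

  Stab≤K : Stab M ≤G K
  Stab≤K g root·g≈root = begin
    root · ψ g              ≈⟨ ·-congʳ (ψ g) φ-root ⟨
    φ M.root · ψ g          ≈⟨ φ-equiv M.root g ⟨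
    φ (M.root M.· g)        ≈⟨ φ-cong root·g≈root ⟩
    φ M.root                ≈⟨ φ-root ⟩
    root                    ∎

  orbit : M.G.Carrier → N.Z.Carrier
  orbit a = root · ψ a

  orbit-∙ : ∀ a g → orbit (a M.G.∙ g) N.Z.≈ (orbit a · ψ g)
  orbit-∙ a g = N.Z.trans (·-congˡ root (ψ.homo a g)) (·-∙ root (ψ a) (ψ g))

  orbit-surjective : ∀ z → ∃ λ a → orbit a N.Z.≈ z
  orbit-surjective z with N.transitive root z
  ... | h , root·h≈z with ψ-epi h
  ...   | a , ψa≈h = a , N.Z.trans (·-congˡ root (ψa≈h M.G.refl)) root·h≈z

  ψ-// : ∀ a b → ψ (a M.G.// b) N.G.≈ (ψ a N.G.// ψ b)
  ψ-// a b = N.G.trans (ψ.homo a (b M.G.⁻¹)) (N.G.∙-congˡ (ψ.⁻¹-homo b))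

  ∼⇒orbit-≈ : ∀ {a b} → a ∼ b → orbit a N.Z.≈ orbit b
  ∼⇒orbit-≈ {a} {b} a∼b = z·[u//v]≈z⇒z·u≈z·v root (ψ a) (ψ b)
    (N.Z.trans (·-congˡ root (N.G.sym (ψ-// a b))) a∼b)

  orbit-≈⇒∼ : ∀ {a b} → orbit a N.Z.≈ orbit b → a ∼ b
  orbit-≈⇒∼ {a} {b} oa≈ob = N.Z.trans (·-congˡ root (ψ-// a b))
    (z·u≈z·v⇒z·[u//v]≈z root (ψ a) (ψ b) oa≈ob)

  ≈H⇒ψ-≈ : ∀ {a b} → a ≈H b → ψ a N.G.≈ ψ b
  ≈H⇒ψ-≈ {a} {b} a≈Hb = N.faithful (ψ a) (ψ b) same-action
    where
      same-action : ∀ z → (z · ψ a) N.Z.≈ (z · ψ b)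
      same-action z with orbit-surjective z
      ... | x , ox≈z = begin
        z · ψ a               ≈⟨ ·-congʳ (ψ a) ox≈z ⟨
        orbit x · ψ a         ≈⟨ orbit-∙ x a ⟨
        orbit (x M.G.∙ a)     ≈⟨ ∼⇒orbit-≈ (a≈Hb x) ⟩
        orbit (x M.G.∙ b)     ≈⟨ orbit-∙ x b ⟩
        orbit x · ψ b         ≈⟨ ·-congʳ (ψ b) ox≈z ⟩
        z · ψ b               ∎

  ψ-≈⇒≈H : ∀ {a b} → ψ a N.G.≈ ψ b → a ≈H b
  ψ-≈⇒≈H {a} {b} ψa≈ψb x = orbit-≈⇒∼ (begin
    orbit (x M.G.∙ a)     ≈⟨ orbit-∙ x a ⟩
    orbit x · ψ a         ≈⟨ ·-congˡ (orbit x) ψa≈ψb ⟩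
    orbit x · ψ b         ≈⟨ orbit-∙ x b ⟨
    orbit (x M.G.∙ b)     ∎)

  ψ-hom/ : IsGroupHom GH N.G ψ
  ψ-hom/ = record
    { isMonoidHomomorphism = record
      { isMagmaHomomorphism = record
        { isRelHomomorphism = record { cong = ≈H⇒ψ-≈ }
        ; homo = ψ.homo }
      ; ε-homo = ψ.ε-homo }
    ; ⁻¹-homo = ψ.⁻¹-homo }

  morphism/ : Morphism (M / K) N
  morphism/ = record
    { ψ = ψ
    ; ψ-hom = ψ-hom/
    ; ψ-epi = λ h → let (a , ψa≈h) = ψ-epi h in
        a , λ b≈Ha → N.G.trans (≈H⇒ψ-≈ b≈Ha) (ψa≈h M.G.refl)
    ; ψ-f = ψ-f
    ; φ = orbit
    ; φ-cong = ∼⇒orbit-≈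
    ; φ-surj = λ z → let (a , oa≈z) = orbit-surjective z in
        a , λ b∼a → N.Z.trans (∼⇒orbit-≈ b∼a) oa≈z
    ; φ-root = N.Z.trans (·-congˡ root ψ.ε-homo) (·-ε root)
    ; φ-equiv = orbit-∙
    }

  isomorphism/ : Isomorphism (M / K) N
  isomorphism/ = record
    { morphism = morphism/
    ; ψ-inj = ψ-≈⇒≈H
    ; φ-inj = orbit-≈⇒∼
    }

theorem2 : (M N : Map) (m : Morphism (Map.premap M) (Map.premap N)) →
             (Stab (Map.premap M) ≤G preimage (Morphism.ψ m) (Morphism.ψ-hom m) (Stab (Map.premap N)))
             × Isomorphism (Map.premap M / preimage (Morphism.ψ m) (Morphism.ψ-hom m) (Stab (Map.premap N))) (Map.premap N)
theorem2 M N m = Stab≤K , isomorphism/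
  where open QuotientByMorphism (Map.premap M) (Map.premap N) m
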